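{- Let $G=(V,E)$ be a 4-regular 4-edge-connected graph, let $T$ be a spanning tree of $G$ with no vertex of degree four in $T$, rooted at a leaf of $T$, and let $L=E\setminus T$. Let $G'=(V',E')$, $T'$ and $L'=E'\setminus T'$ be the subdivided graph, tree and links. Then: (1) for any $F'\subseteq L'$ such that $T'+F'$ is 2-edge-connected, the graph $T+F$ is 2-vertex-connected, where $F\subseteq L$ is the set of links corresponding to $F'$; and (2) for every edge $e'\in T'$ there are at least two links $\ell'_1,\ell'_2\in L'$ whose tree paths in $T'$ contain $e'$.
   Context: For a link $\ell\in L$, $P_\ell$ is the unique path in $T$ between its endpoints. The subdivided graph $G'$ is obtained by subdividing each tree edge $e=uw\in T$ by a new vertex $v_e$ into $uv_e$ and $v_ew$; $T'$ consists of all these subdivided tree edges. For each link $\ell\in L$ a link $\ell'\in L'$ is created: for each endpoint $u$ of $\ell$, if $u$ is the root or a leaf of $T$ then $u$ is an endpoint of $\ell'$; if $u$ is an internal vertex of $T$, then letting $e$ be the (unique) edge of $P_\ell$ incident to $u$, the vertex $v_e$ is an endpoint of $\ell'$. This is a bijection between $L$ and $L'$, and for $F'\subseteq L'$ the corresponding set $F\subseteq L$ is its preimage. For a link $\ell'\in L'$, its tree path is the unique path in $T'$ between its endpoints. -}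

module Defs where

open import Data.Nat using (ℕ; _<_)
open import Data.Fin using (Fin)
open import Data.Fin.Properties using () renaming (_≟_ to _≟ᶠ_)
open import Data.Bool using (Bool; true; false; _∧_; _∨_; T)
open import Data.Bool.Properties using (T?)
open import Data.Product using (Σ; Σ-syntax; ∃; _×_; _,_; proj₁; proj₂)
open import Data.Sum using (_⊎_; inj₁; inj₂)
open import Data.List using (List; []; _∷_; length; filter; allFin)
open import Data.List.Membership.Propositional using (_∈_; _∉_)
open import Data.List.Relation.Unary.Unique.Propositional using (Unique)
open import Data.Maybe using (Maybe; just; nothing)
open import Data.Unit using (⊤)
open import Data.Empty using (⊥)
open import Relation.Binary.PropositionalEquality using (_≡_; _≢_)
open import Relation.Nullary using (¬_; does)

-- General (multi)graphs: vertex type, edge type, endpoint map.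
-- Subgraphs are spanning subgraphs given by a predicate on edges.

record Graph : Set₁ where
  constructor mkGraph
  field
    V    : Set
    E    : Set
    ends : E → V × V

module _ (G : Graph) where
  open Graph G

  Joins : E → V → V → Set
  Joins e u w = (ends e ≡ (u , w)) ⊎ (ends e ≡ (w , u))

  Incident : E → V → Set
  Incident e x = (proj₁ (ends e) ≡ x) ⊎ (proj₂ (ends e) ≡ x)

  data Walk (S : E → Set) : V → V → Set where
    nil  : ∀ {u} → Walk S u u
    cons : ∀ {u w v} (e : E) → S e → Joins e u w → Walk S w v → Walk S u v

  walkEdges : ∀ {S u v} → Walk S u v → List E
  walkEdges nil = []
  walkEdges (cons e _ _ p) = e ∷ walkEdges p

  walkVerts : ∀ {S u v} → Walk S u v → List V
  walkVerts {u = u} nil = u ∷ []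
  walkVerts {u = u} (cons e _ _ p) = u ∷ walkVerts p

  firstEdge : ∀ {S u v} → Walk S u v → Maybe E
  firstEdge nil = nothing
  firstEdge (cons e _ _ _) = just e

  Path : (E → Set) → V → V → Set
  Path S u v = Σ (Walk S u v) (λ p → Unique (walkVerts p))

  Connected : (E → Set) → Set
  Connected S = ∀ u v → Walk S u v

  Minus : (E → Set) → List E → E → Set
  Minus S D e = S e × e ∉ D

  EdgeConnected : ℕ → (E → Set) → Set
  EdgeConnected k S = ∀ (D : List E) → length D < k → Connected (Minus S D)

  MinusV : (E → Set) → V → E → Set
  MinusV S x e = S e × ¬ Incident e x

  TwoVertexConnected : (E → Set) → Set
  TwoVertexConnected S =
    (Σ[ a ∈ V ] Σ[ b ∈ V ] Σ[ c ∈ V ] (a ≢ b × a ≢ c × b ≢ c)) ×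
    (∀ x u v → u ≢ x → v ≢ x → Walk (MinusV S x) u v)

  Acyclic : (E → Set) → Set
  Acyclic S = ∀ u (w : Walk S u u) → Unique (walkEdges w) → walkEdges w ≡ []

  SpanningTree : (E → Set) → Set
  SpanningTree S = Connected S × Acyclic S

module _ {n m : ℕ} (ends : Fin m → Fin n × Fin n) where

  G : Graph
  G = mkGraph (Fin n) (Fin m) ends

  -- simple: no loops, no parallel edges
  Simple : Set
  Simple = (∀ e → proj₁ (ends e) ≢ proj₂ (ends e)) ×
           (∀ e f → Joins G f (proj₁ (ends e)) (proj₂ (ends e)) → e ≡ f)

  incb : Fin m → Fin n → Bool
  incb e v = does (proj₁ (ends e) ≟ᶠ v) ∨ does (proj₂ (ends e) ≟ᶠ v)

  deg : (Fin m → Bool) → Fin n → ℕ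
  deg S v = length (filter (λ e → T? (S e ∧ incb e v)) (allFin m))

  Regular : ℕ → Set
  Regular k = ∀ v → deg (λ _ → true) v ≡ k

  In : (Fin m → Bool) → Fin m → Set
  In S e = S e ≡ true

  module _ (Tr : Fin m → Bool) (r : Fin n) where
    TE : Set
    TE = Σ (Fin m) (λ e → Tr e ≡ true)

    LE : Set
    LE = Σ (Fin m) (λ e → Tr e ≡ false)

    -- vertices of G': original vertices plus one subdivision vertex v_e per tree edge
    V' : Set
    V' = Fin n ⊎ TE

    -- edges of G': two halves of each tree edge (T'), plus the links (L')
    E' : Set
    E' = (TE × Bool) ⊎ LE

    RootOrLeaf : Fin n → Set
    RootOrLeaf u = (u ≡ r) ⊎ (deg Tr u ≡ 1)

    -- x is the endpoint of ℓ' corresponding to the endpoint u of ℓ, where w is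
    -- the other endpoint of ℓ
    EndSpec : Fin n → Fin n → V' → Set
    EndSpec u w x =
      (RootOrLeaf u → x ≡ inj₁ u) ×
      (¬ RootOrLeaf u →
        Σ[ t ∈ TE ] (x ≡ inj₂ t ×
          Σ[ p ∈ Path G (In Tr) u w ] (firstEdge G (proj₁ p) ≡ just (proj₁ t))))

    -- lend is the map ℓ ↦ endpoints of ℓ'
    LinkSpec : (LE → V' × V') → Set
    LinkSpec lend = ∀ (ℓ : LE) →
      EndSpec (proj₁ (ends (proj₁ ℓ))) (proj₂ (ends (proj₁ ℓ))) (proj₁ (lend ℓ)) ×
      EndSpec (proj₂ (ends (proj₁ ℓ))) (proj₁ (ends (proj₁ ℓ))) (proj₂ (lend ℓ))

    module _ (lend : LE → V' × V') where
      ends' : E' → V' × V'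
      ends' (inj₁ ((e , p) , true))  = inj₁ (proj₁ (ends e)) , inj₂ (e , p)
      ends' (inj₁ ((e , p) , false)) = inj₂ (e , p) , inj₁ (proj₂ (ends e))
      ends' (inj₂ ℓ) = lend ℓ

      G' : Graph
      G' = mkGraph V' E' ends'

      T' : E' → Set
      T' (inj₁ _) = ⊤
      T' (inj₂ _) = ⊥

      T'+ : (LE → Bool) → E' → Set
      T'+ F' (inj₁ _) = ⊤
      T'+ F' (inj₂ ℓ) = F' ℓ ≡ true

      T+ : (LE → Bool) → Fin m → Set
      T+ F' e = (Tr e ≡ true) ⊎ (Σ[ p ∈ Tr e ≡ false ] (F' (e , p) ≡ true))

      TreePathContains : LE → TE × Bool → Set
      TreePathContains ℓ e' =
        Σ[ p ∈ Path G' T' (proj₁ (lend ℓ)) (proj₂ (lend ℓ)) ] (inj₁ e' ∈ walkEdges G' (proj₁ p))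

module Submission where

-- Both parts rest on the fundamental cut of a tree edge f = uw: deleting f
-- from T splits V into u's side and w's side ('side').  Extending this to V'
-- by putting v_f on w's side ('side''), the half-edge u v_f is the only edge
-- of T' whose ends lie on different sides, and the end of ℓ' chosen for an
-- end a ≠ u of a link ℓ lies on the side of a.  Hence:
--   (2) every link ℓ' separated by side' covers u v_f; if at most one link
--       were separated, deleting it together with one of two classes of the
--       four edges at u (at most three edges in all) would disconnect G;
--   (1) for a tree edge f at an internal vertex x, a path in T' + F' avoiding
--       the half-edge x v_f crosses the cut along a link of F that "jumps"
--       over x from the branch of f to another branch of T at x; as x has at
--       most three tree edges, such jumps connect all branches at x.

open import Defs
open import Data.Nat using (ℕ; suc; _+_; _≤_; _<_; z≤n; s≤s) renaming (_≟_ to _≟ⁿ_)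
import Data.Nat.Properties as ℕ
open import Data.Fin using (Fin)
open import Data.Fin.Properties using () renaming (_≟_ to _≟ᶠ_)
open import Data.Bool using (Bool; true; false; _∧_; _∨_; _xor_; not)
open import Data.Bool.Properties using (T?; T-≡; ∨-zeroʳ; ∧-zeroʳ; ∨-comm) renaming (_≟_ to _≟ᵇ_)
open import Data.Unit using (⊤; tt)
open import Data.Empty using (⊥; ⊥-elim)
open import Data.Product using (Σ-syntax; _×_; _,_; proj₁; proj₂)
import Data.Product.Properties as Product
open import Data.Sum using (_⊎_; inj₁; inj₂)
import Data.Sum.Properties as Sum
open import Data.List using (List; []; _∷_; length; filter; allFin; _++_)
open import Data.List.Properties using (length-++)
open import Data.List.Relation.Unary.All using (All; []; _∷_)
import Data.List.Relation.Unary.All as All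
open import Data.List.Relation.Unary.All.Properties using (¬Any⇒All¬)
open import Data.List.Relation.Unary.Any using (here; there)
open import Data.List.Relation.Unary.AllPairs using ([]; _∷_)
open import Data.List.Membership.Propositional using (_∈_)
open import Data.List.Membership.Propositional.Properties
  using (∈-filter⁺; ∈-filter⁻; ∈-allFin; ∈-++⁺ˡ; ∈-++⁺ʳ)
open import Data.List.Relation.Unary.Unique.Propositional using (Unique)
import Data.List.Relation.Unary.Unique.Propositional.Properties as Unique
open import Function.Bundles using (Equivalence)
open import Relation.Binary.PropositionalEquality
open import Relation.Nullary using (¬_; Dec; yes; no; does)
open import Relation.Nullary.Decidable using (toSum)
open import Relation.Binary using (DecidableEquality)
open import Axiom.UniquenessOfIdentityProofs using (module Decidable⇒UIP)

-- Proofs of b ≡ true are unique; needed to compare tree edges and links,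
-- which carry such a proof.
≡true-irrelevant : ∀ {b : Bool} (p q : b ≡ true) → p ≡ q
≡true-irrelevant = Decidable⇒UIP.≡-irrelevant _≟ᵇ_

≡false-irrelevant : ∀ {b : Bool} (p q : b ≡ false) → p ≡ q
≡false-irrelevant = Decidable⇒UIP.≡-irrelevant _≟ᵇ_

false≢true : false ≢ true
false≢true ()

≡false∧≡true⇒≢ : ∀ {a b : Bool} → a ≡ false → b ≡ true → a ≢ b
≡false∧≡true⇒≢ a≡false b≡true a≡b = false≢true (trans (sym a≡false) (trans a≡b b≡true))

∧≡true⁻ : ∀ {a b} → a ∧ b ≡ true → (a ≡ true) × (b ≡ true)
∧≡true⁻ {true} {true} _ = refl , refl

xor⇒≢ : ∀ {a b} → a xor b ≡ true → a ≢ b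
xor⇒≢ {true}  {true}  ()
xor⇒≢ {false} {false} ()
xor⇒≢ {true}  {false} _ ()
xor⇒≢ {false} {true}  _ ()

≢⇒xor : ∀ {a b} → a ≢ b → a xor b ≡ true
≢⇒xor {true}  {true}  a≢b = ⊥-elim (a≢b refl)
≢⇒xor {false} {false} a≢b = ⊥-elim (a≢b refl)
≢⇒xor {true}  {false} _ = refl
≢⇒xor {false} {true}  _ = refl

small-plus-one-part : ∀ x a b → x ≤ 1 → a + b ≡ 4 → (x + a < 4) ⊎ (x + b < 4)
small-plus-one-part x a b x≤1 a+b≡4 with a ℕ.≤? 2 | b ℕ.≤? 1
... | yes a≤2 | _ = inj₁ (s≤s (ℕ.+-mono-≤ x≤1 a≤2))
... | no _ | yes b≤1 = inj₂ (s≤s (ℕ.+-mono-≤ x≤1 (ℕ.≤-trans b≤1 (s≤s z≤n))))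
... | no a≰2 | no b≰1 =
  ⊥-elim (ℕ.<-irrefl refl (subst (4 <_) a+b≡4 (ℕ.+-mono-≤ (ℕ.≰⇒> a≰2) (ℕ.≰⇒> b≰1))))

module Walks (Γ : Graph) where
  open Graph Γ

  Joins-sym : ∀ {e a b} → Joins Γ e a b → Joins Γ e b a
  Joins-sym (inj₁ p) = inj₂ p
  Joins-sym (inj₂ p) = inj₁ p

  Joins-unique : ∀ {e a b c d} → Joins Γ e a b → Joins Γ e c d →
                 ((a ≡ c) × (b ≡ d)) ⊎ ((a ≡ d) × (b ≡ c))
  Joins-unique (inj₁ p) (inj₁ q) = let pq = trans (sym p) q in
    inj₁ (cong proj₁ pq , cong proj₂ pq)
  Joins-unique (inj₁ p) (inj₂ q) = let pq = trans (sym p) q in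
    inj₂ (cong proj₁ pq , cong proj₂ pq)
  Joins-unique (inj₂ p) (inj₁ q) = let pq = trans (sym p) q in
    inj₂ (cong proj₂ pq , cong proj₁ pq)
  Joins-unique (inj₂ p) (inj₂ q) = let pq = trans (sym p) q in
    inj₁ (cong proj₂ pq , cong proj₁ pq)

  Joins-other : ∀ {e a b b'} → Joins Γ e a b → Joins Γ e a b' → b ≡ b'
  Joins-other j j' with Joins-unique j j'
  ... | inj₁ (_ , b≡b') = b≡b'
  ... | inj₂ (a≡b' , b≡a) = trans b≡a a≡b'

  Joins-other-≡ : ∀ {e e' a b b'} → e ≡ e' → Joins Γ e a b → Joins Γ e' a b' → b ≡ b'
  Joins-other-≡ refl = Joins-other

  infixr 5 _++ʷ_
  _++ʷ_ : ∀ {S a b c} → Walk Γ S a b → Walk Γ S b c → Walk Γ S a c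
  nil ++ʷ q = q
  cons e s j p ++ʷ q = cons e s j (p ++ʷ q)

  reverseʷ : ∀ {S a b} → Walk Γ S a b → Walk Γ S b a
  reverseʷ nil = nil
  reverseʷ (cons e s j p) = reverseʷ p ++ʷ cons e s (Joins-sym j) nil

  mapʷ : ∀ {S S' : E → Set} {a b} → (∀ {e} → S e → S' e) → Walk Γ S a b → Walk Γ S' a b
  mapʷ g nil = nil
  mapʷ g (cons e s j p) = cons e (g s) j (mapʷ g p)

  mapʷ-edges : ∀ {S S' : E → Set} {a b} (g : ∀ {e} → S e → S' e) (p : Walk Γ S a b) →
               walkEdges Γ (mapʷ g p) ≡ walkEdges Γ p
  mapʷ-edges g nil = refl
  mapʷ-edges g (cons e s j p) = cong (e ∷_) (mapʷ-edges g p)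

  walk-to-equal : ∀ {S a b} → a ≡ b → Walk Γ S a b
  walk-to-equal refl = nil

  crossingEdge : ∀ {S a b} (σ : V → Bool) (p : Walk Γ S a b) → σ a ≡ false → σ b ≡ true →
    Σ[ e ∈ E ] Σ[ c ∈ V ] Σ[ d ∈ V ]
      (S e × Joins Γ e c d × σ c ≡ false × σ d ≡ true × e ∈ walkEdges Γ p)
  crossingEdge σ nil σa σb = ⊥-elim (false≢true (trans (sym σa) σb))
  crossingEdge σ (cons {w = w} e s j p) σa σb with σ w in σw
  ... | true = e , _ , w , s , j , σa , σw , here refl
  ... | false with crossingEdge σ p σw σb
  ...   | e' , c , d , s' , j' , σc , σd , e'∈p = e' , c , d , s' , j' , σc , σd , there e'∈p

  separatingEdge : ∀ {S a b} (σ : V → Bool) (p : Walk Γ S a b) → σ a ≢ σ b →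
    Σ[ e ∈ E ] Σ[ c ∈ V ] Σ[ d ∈ V ] (S e × Joins Γ e c d × σ c ≢ σ d × e ∈ walkEdges Γ p)
  separatingEdge {a = a} {b} σ p σa≢σb with σ a in σa | σ b in σb
  ... | true  | true  = ⊥-elim (σa≢σb refl)
  ... | false | false = ⊥-elim (σa≢σb refl)
  ... | false | true with crossingEdge σ p σa σb
  ...   | e , c , d , s , j , σc , σd , e∈p =
          e , c , d , s , j , (λ σc≡σd → false≢true (trans (sym σc) (trans σc≡σd σd))) , e∈p
  separatingEdge {a = a} {b} σ p σa≢σb | true | false
    with crossingEdge (λ v → not (σ v)) p (cong not σa) (cong not σb)
  ...   | e , c , d , s , j , σc , σd , e∈p =
          e , c , d , s , j , (λ σc≡σd → false≢true (trans (sym σc) (trans (cong not σc≡σd) σd))) , e∈p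

  head∈walkVerts : ∀ {S a b} (p : Walk Γ S a b) → a ∈ walkVerts Γ p
  head∈walkVerts nil = here refl
  head∈walkVerts (cons e s j p) = here refl

  All-head : ∀ {S a b} {P : V → Set} (p : Walk Γ S a b) → All P (walkVerts Γ p) → P a
  All-head nil (Pa ∷ _) = Pa
  All-head (cons e s j p) (Pa ∷ _) = Pa

  edge-ends∈walkVerts : ∀ {S a b e} (p : Walk Γ S a b) → e ∈ walkEdges Γ p →
     Σ[ c ∈ V ] Σ[ d ∈ V ] (Joins Γ e c d × c ∈ walkVerts Γ p × d ∈ walkVerts Γ p)
  edge-ends∈walkVerts (cons e s j p) (here refl) = _ , _ , j , here refl , there (head∈walkVerts p)
  edge-ends∈walkVerts (cons e s j p) (there e∈p) with edge-ends∈walkVerts p e∈p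
  ... | c , d , j' , c∈p , d∈p = c , d , j' , there c∈p , there d∈p

  path-edges-unique : ∀ {S a b} (p : Walk Γ S a b) → Unique (walkVerts Γ p) → Unique (walkEdges Γ p)
  path-edges-unique nil _ = []
  path-edges-unique (cons e s j p) (a∉p ∷ uniq) = ¬Any⇒All¬ _ e∉p ∷ path-edges-unique p uniq
    where
    e∉p : ¬ (e ∈ walkEdges Γ p)
    e∉p e∈p with edge-ends∈walkVerts p e∈p
    ... | c , d , j' , c∈p , d∈p with Joins-unique j j'
    ...   | inj₁ (a≡c , _) = All.lookup a∉p c∈p a≡c
    ...   | inj₂ (a≡d , _) = All.lookup a∉p d∈p a≡d

  module Shortcut (_≟_ : DecidableEquality V) where
    open import Data.List.Membership.DecPropositional _≟_ using (_∈?_)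

    suffixPath : ∀ {S a b u} (p : Walk Γ S a b) → Unique (walkVerts Γ p) → u ∈ walkVerts Γ p →
                 Path Γ S u b
    suffixPath nil uniq (here refl) = nil , uniq
    suffixPath (cons e s j p) uniq (here refl) = cons e s j p , uniq
    suffixPath (cons e s j p) (_ ∷ uniq) (there u∈p) = suffixPath p uniq u∈p

    shortcut : ∀ {S a b} → Walk Γ S a b → Path Γ S a b
    shortcut nil = nil , ([] ∷ [])
    shortcut {a = a} (cons e s j p) with shortcut p
    ... | q , uniq with a ∈? walkVerts Γ q
    ...   | yes a∈q = suffixPath q uniq a∈q
    ...   | no a∉q = cons e s j q , (¬Any⇒All¬ _ a∉q ∷ uniq)

module Counting {A : Set} where

  select : (A → Bool) → List A → List A
  select q = filter (λ x → T? (q x))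

  count : (A → Bool) → List A → ℕ
  count q xs = length (select q xs)

  ∈-select⁺ : ∀ q {x xs} → x ∈ xs → q x ≡ true → x ∈ select q xs
  ∈-select⁺ q x∈xs qx = ∈-filter⁺ (λ y → T? (q y)) x∈xs (Equivalence.from T-≡ qx)

  ∈-select⁻ : ∀ q {x} xs → x ∈ select q xs → q x ≡ true
  ∈-select⁻ q xs x∈ = Equivalence.to T-≡ (proj₂ (∈-filter⁻ (λ y → T? (q y)) {xs = xs} x∈))

  select-unique : ∀ q {xs} → Unique xs → Unique (select q xs)
  select-unique q = Unique.filter⁺ (λ y → T? (q y))

  count-split : ∀ (i p : A → Bool) xs →
    count (λ x → i x ∧ p x) xs + count (λ x → i x ∧ not (p x)) xs ≡ count i xs
  count-split i p [] = refl
  count-split i p (x ∷ xs) with i x | p x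
  ... | false | _     = count-split i p xs
  ... | true  | true  = cong suc (count-split i p xs)
  ... | true  | false = trans (ℕ.+-suc _ _) (cong suc (count-split i p xs))

  remove : ∀ {a} (xs : List A) → a ∈ xs →
    Σ[ xs' ∈ List A ] (length xs ≡ suc (length xs') × (∀ {z} → z ∈ xs → z ≢ a → z ∈ xs'))
  remove (x ∷ xs) (here refl) =
    xs , refl , λ { (here refl) z≢a → ⊥-elim (z≢a refl) ; (there z∈) _ → z∈ }
  remove (x ∷ xs) (there a∈xs) with remove xs a∈xs
  ... | xs' , len , keep =
    x ∷ xs' , cong suc len , λ { (here refl) _ → here refl ; (there z∈) z≢a → there (keep z∈ z≢a) }

  unique-⊆-length : ∀ (ys xs : List A) → Unique ys → (∀ {z} → z ∈ ys → z ∈ xs) →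
                    length ys ≤ length xs
  unique-⊆-length [] xs _ _ = z≤n
  unique-⊆-length (y ∷ ys) xs (y∉ys ∷ uniq) ys⊆xs with remove xs (ys⊆xs (here refl))
  ... | xs' , len , keep =
    subst (suc (length ys) ≤_) (sym len)
      (s≤s (unique-⊆-length ys xs' uniq
        (λ z∈ys → keep (ys⊆xs (there z∈ys)) (λ z≡y → All.lookup y∉ys z∈ys (sym z≡y)))))

  two-elements : ∀ (xs : List A) → Unique xs → 2 ≤ length xs → Σ[ x ∈ A ] Σ[ y ∈ A ] (x ∈ xs × y ∈ xs × x ≢ y)
  two-elements (x ∷ y ∷ _) ((x≢y ∷ _) ∷ _) _ = x , y , here refl , there (here refl) , x≢y
  two-elements (_ ∷ []) _ (s≤s ())

  another-element : ∀ {f} (xs : List A) → Unique xs → f ∈ xs → length xs ≢ 1 →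
                    Σ[ g ∈ A ] (g ∈ xs × g ≢ f)
  another-element (x ∷ []) _ _ len≢1 = ⊥-elim (len≢1 refl)
  another-element (x ∷ y ∷ xs) ((x≢y ∷ _) ∷ _) (here refl) _ = y , there (here refl) , λ y≡x → x≢y (sym y≡x)
  another-element (x ∷ y ∷ xs) (x∉tail ∷ _) (there f∈tail) _ = x , here refl , All.lookup x∉tail f∈tail

module Lemma15
  {n m : ℕ} (ends : Fin m → Fin n × Fin n)
  (simple : Simple ends) (regular : Regular ends 4) (edgeConn : EdgeConnected (G ends) 4 (λ _ → ⊤))
  (Tr : Fin m → Bool) (spanning : SpanningTree (G ends) (In ends Tr))
  (noTreeDeg4 : ∀ v → deg ends Tr v ≢ 4)
  (r : Fin n) (rootIsLeaf : deg ends Tr r ≡ 1)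
  (lend : LE ends Tr r → V' ends Tr r × V' ends Tr r) (linkSpec : LinkSpec ends Tr r lend)
  where

  open Walks (G ends)
  open Shortcut _≟ᶠ_
  open Counting

  Tree : Fin m → Set
  Tree = In ends Tr

  Link TreeEdge Vertex' : Set
  Link = LE ends Tr r
  TreeEdge = TE ends Tr r
  Vertex' = V' ends Tr r

  Subdivided : Graph
  Subdivided = G' ends Tr r lend

  module SubWalks = Walks Subdivided

  RL : Fin n → Set
  RL = RootOrLeaf ends Tr r

  src tgt : Fin m → Fin n
  src e = proj₁ (ends e)
  tgt e = proj₂ (ends e)

  tree-walk : ∀ a b → Walk (G ends) Tree a b
  tree-walk = proj₁ spanning

  rootOrLeaf? : ∀ a → Dec (RL a)
  rootOrLeaf? a with a ≟ᶠ r | deg ends Tr a ≟ⁿ 1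
  ... | yes a≡r | _ = yes (inj₁ a≡r)
  ... | no _ | yes deg≡1 = yes (inj₂ deg≡1)
  ... | no a≢r | no deg≢1 = no λ { (inj₁ a≡r) → a≢r a≡r ; (inj₂ deg≡1) → deg≢1 deg≡1 }

  Joins-distinct : ∀ {e a b} → Joins (G ends) e a b → a ≢ b
  Joins-distinct {e} (inj₁ p) a≡b = proj₁ simple e (trans (cong proj₁ p) (trans a≡b (sym (cong proj₂ p))))
  Joins-distinct {e} (inj₂ p) a≡b = proj₁ simple e (trans (cong proj₁ p) (trans (sym a≡b) (sym (cong proj₂ p))))

  src-end : ∀ {e a b} → Joins (G ends) e a b → (src e ≡ a) ⊎ (src e ≡ b)
  src-end (inj₁ p) = inj₁ (cong proj₁ p)
  src-end (inj₂ p) = inj₂ (cong proj₁ p)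

  Joins⇒¬Incident : ∀ {e c d x} → Joins (G ends) e c d → c ≢ x → d ≢ x → ¬ Incident (G ends) e x
  Joins⇒¬Incident (inj₁ p) c≢x d≢x (inj₁ i) = c≢x (trans (sym (cong proj₁ p)) i)
  Joins⇒¬Incident (inj₁ p) c≢x d≢x (inj₂ i) = d≢x (trans (sym (cong proj₂ p)) i)
  Joins⇒¬Incident (inj₂ p) c≢x d≢x (inj₁ i) = d≢x (trans (sym (cong proj₁ p)) i)
  Joins⇒¬Incident (inj₂ p) c≢x d≢x (inj₂ i) = c≢x (trans (sym (cong proj₂ p)) i)

  Joins⇒Incident : ∀ {e a b} → Joins (G ends) e a b → Incident (G ends) e a
  Joins⇒Incident (inj₁ p) = inj₁ (cong proj₁ p)
  Joins⇒Incident (inj₂ p) = inj₂ (cong proj₂ p)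

  Joins⇒incb : ∀ {e a b} → Joins (G ends) e a b → incb ends e a ≡ true
  Joins⇒incb {e} {a} j with src e ≟ᶠ a | tgt e ≟ᶠ a | j
  ... | yes _ | _ | _ = refl
  ... | no _ | yes _ | _ = refl
  ... | no src≢a | no _ | inj₁ p = ⊥-elim (src≢a (cong proj₁ p))
  ... | no _ | no tgt≢a | inj₂ p = ⊥-elim (tgt≢a (cong proj₂ p))

  incb⇒Joins : ∀ {e a} → incb ends e a ≡ true → Σ[ b ∈ Fin n ] Joins (G ends) e a b
  incb⇒Joins {e} {a} inc with src e ≟ᶠ a | tgt e ≟ᶠ a
  ... | yes src≡a | _ = tgt e , inj₁ (cong (_, tgt e) src≡a)
  ... | no _ | yes tgt≡a = src e , inj₂ (cong (src e ,_) tgt≡a)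
  incb⇒Joins () | no _ | no _

  via-ends : ∀ {e c d} (P : Fin n → Fin n → Set) → (∀ {a b} → P a b → P b a) →
             Joins (G ends) e c d → P c d → P (src e) (tgt e)
  via-ends P P-sym (inj₁ p) Pcd = subst₂ P (sym (cong proj₁ p)) (sym (cong proj₂ p)) Pcd
  via-ends P P-sym (inj₂ p) Pcd = P-sym (subst₂ P (sym (cong proj₂ p)) (sym (cong proj₁ p)) Pcd)

  no-parallel : ∀ {e e' a b} → Joins (G ends) e a b → Joins (G ends) e' a b → e ≡ e'
  no-parallel {e} {e'} j j' = proj₂ simple e e' (via-ends (Joins (G ends) e') Joins-sym j j')

  enteringEdge : ∀ {c x} → Walk (G ends) Tree c x → c ≢ x →
    Σ[ g ∈ Fin m ] Σ[ z ∈ Fin n ] (Tr g ≡ true × Joins (G ends) g x z × Walk (G ends) (MinusV (G ends) Tree x) c z)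
  enteringEdge nil c≢x = ⊥-elim (c≢x refl)
  enteringEdge {c} {x} (cons {w = c'} e s j p) c≢x with c' ≟ᶠ x
  ... | yes refl = e , c , s , Joins-sym j , nil
  ... | no c'≢x with enteringEdge p c'≢x
  ...   | g , z , g∈T , g-xz , c'→z = g , z , g∈T , g-xz , cons e (s , Joins⇒¬Incident j c≢x c'≢x) j c'→z

  walk-avoiding : (D₁ D₂ : List (Fin m)) → length D₁ + length D₂ < 4 →
                  ∀ a b → Walk (G ends) (Minus (G ends) (λ _ → ⊤) (D₁ ++ D₂)) a b
  walk-avoiding D₁ D₂ small = edgeConn (D₁ ++ D₂) (subst (_< 4) (sym (length-++ D₁)) small)

  treeEdgesAt : Fin n → List (Fin m)
  treeEdgesAt x = select (λ e → Tr e ∧ incb ends e x) (allFin m)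

  treeEdgesAt-unique : ∀ x → Unique (treeEdgesAt x)
  treeEdgesAt-unique x = select-unique _ (Unique.allFin⁺ m)

  ∈treeEdgesAt⁺ : ∀ {g x y} → Tr g ≡ true → Joins (G ends) g x y → g ∈ treeEdgesAt x
  ∈treeEdgesAt⁺ g∈T j = ∈-select⁺ _ (∈-allFin _) (cong₂ _∧_ g∈T (Joins⇒incb j))

  ∈treeEdgesAt⁻ : ∀ {g x} → g ∈ treeEdgesAt x → Σ[ y ∈ Fin n ] (Tr g ≡ true × Joins (G ends) g x y)
  ∈treeEdgesAt⁻ g∈ with ∧≡true⁻ (∈-select⁻ _ (allFin m) g∈)
  ... | g∈T , inc with incb⇒Joins inc
  ...   | y , j = y , g∈T , j

  SubTree : E' ends Tr r → Set
  SubTree = T' ends Tr r lend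

  _≟'_ : DecidableEquality Vertex'
  _≟'_ = Sum.≡-dec _≟ᶠ_ (Product.≡-dec _≟ᶠ_ (λ p q → yes (≡true-irrelevant p q)))

  liftToT' : ∀ {a b} → Walk (G ends) Tree a b → Walk Subdivided SubTree (inj₁ a) (inj₁ b)
  liftToT' nil = nil
  liftToT' (cons e s (inj₁ p) q) =
    cons (inj₁ ((e , s) , true)) tt (inj₁ (cong (λ z → inj₁ (proj₁ z) , inj₂ (e , s)) p))
      (cons (inj₁ ((e , s) , false)) tt (inj₁ (cong (λ z → inj₂ (e , s) , inj₁ (proj₂ z)) p))
        (liftToT' q))
  liftToT' (cons e s (inj₂ p) q) =
    cons (inj₁ ((e , s) , false)) tt (inj₂ (cong (λ z → inj₂ (e , s) , inj₁ (proj₂ z)) p))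
      (cons (inj₁ ((e , s) , true)) tt (inj₂ (cong (λ z → inj₁ (proj₁ z) , inj₂ (e , s)) p))
        (liftToT' q))

  anchor : Vertex' → Fin n
  anchor (inj₁ v) = v
  anchor (inj₂ (t , _)) = src t

  toAnchor : ∀ x → Walk Subdivided SubTree x (inj₁ (anchor x))
  toAnchor (inj₁ v) = nil
  toAnchor (inj₂ t) = cons (inj₁ (t , true)) tt (inj₂ refl) nil

  shortcut' : ∀ {S x y} → Walk Subdivided S x y → Path Subdivided S x y
  shortcut' = SubWalks.Shortcut.shortcut _≟'_

  T'-walk : ∀ x y → Walk Subdivided SubTree x y
  T'-walk x y = toAnchor x SubWalks.++ʷ (liftToT' (tree-walk (anchor x) (anchor y)) SubWalks.++ʷ SubWalks.reverseʷ (toAnchor y))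

  -- The fundamental cut of a tree edge f = uw

  Tree-minus : Fin m → Fin m → Set
  Tree-minus f e = (Tr e ≡ true) × (e ≢ f)

  Tree-minus-avoids : ∀ {f a b} (q : Walk (G ends) (Tree-minus f) a b) → All (f ≢_) (walkEdges (G ends) q)
  Tree-minus-avoids nil = []
  Tree-minus-avoids (cons e (_ , e≢f) _ q) = (λ f≡e → e≢f (sym f≡e)) ∷ Tree-minus-avoids q

  avoidingVertex⇒avoidingEdge : ∀ {f u c d} → Incident (G ends) f u →
    Walk (G ends) (MinusV (G ends) Tree u) c d → Walk (G ends) (Tree-minus f) c d
  avoidingVertex⇒avoidingEdge f-at-u = mapʷ λ { {e} (s , e∌u) → s , λ { refl → e∌u f-at-u } }

  module FundamentalCut (f : Fin m) (f∈T : Tr f ≡ true) (u w : Fin n) (f-uw : Joins (G ends) f u w) where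

    -- Following a tree walk from v until it first uses f reaches u or w,
    -- so every vertex is joined to u or to w in T − f.
    untilF : ∀ {v z} → Walk (G ends) Tree v z →
      Walk (G ends) (Tree-minus f) v u ⊎ Walk (G ends) (Tree-minus f) v w ⊎ Walk (G ends) (Tree-minus f) v z
    untilF nil = inj₂ (inj₂ nil)
    untilF (cons e s j p) with e ≟ᶠ f
    ... | yes refl with Joins-unique j f-uw
    ...   | inj₁ (v≡u , _) = inj₁ (walk-to-equal v≡u)
    ...   | inj₂ (v≡w , _) = inj₂ (inj₁ (walk-to-equal v≡w))
    untilF (cons e s j p) | no e≢f with untilF p
    ... | inj₁ q = inj₁ (cons e (s , e≢f) j q)
    ... | inj₂ (inj₁ q) = inj₂ (inj₁ (cons e (s , e≢f) j q))
    ... | inj₂ (inj₂ q) = inj₂ (inj₂ (cons e (s , e≢f) j q))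

    toUorW : ∀ v → Walk (G ends) (Tree-minus f) v u ⊎ Walk (G ends) (Tree-minus f) v w
    toUorW v with untilF (tree-walk v w)
    ... | inj₁ q = inj₁ q
    ... | inj₂ (inj₁ q) = inj₂ q
    ... | inj₂ (inj₂ q) = inj₂ q

    -- side v is true when v lies on w's side of the cut
    side : Fin n → Bool
    side v with toUorW v
    ... | inj₁ _ = false
    ... | inj₂ _ = true

    toW : ∀ v → side v ≡ true → Walk (G ends) (Tree-minus f) v w
    toW v sv with toUorW v
    toW v () | inj₁ _
    ... | inj₂ q = q

    toU : ∀ v → side v ≡ false → Walk (G ends) (Tree-minus f) v u
    toU v sv with toUorW v
    toU v () | inj₂ _
    ... | inj₁ q = q

    f-bridge : ¬ Walk (G ends) (Tree-minus f) u w
    f-bridge p with shortcut p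
    ... | q , uniq with proj₂ spanning w (cons f f∈T (Joins-sym f-uw) (mapʷ proj₁ q))
                          (subst Unique (cong (f ∷_) (sym (mapʷ-edges proj₁ q)))
                            (Tree-minus-avoids q ∷ path-edges-unique q uniq))
    ... | ()

    side-u : side u ≡ false
    side-u with side u in su
    ... | true = ⊥-elim (f-bridge (toW u su))
    ... | false = refl

    side-w : side w ≡ true
    side-w with side w in sw
    ... | true = refl
    ... | false = ⊥-elim (f-bridge (reverseʷ (toU w sw)))

    same-side : ∀ {e c d} → Tr e ≡ true → e ≢ f → Joins (G ends) e c d → side c ≡ side d
    same-side {e} {c} {d} s e≢f j with side c in sc | side d in sd
    ... | true | true = refl
    ... | false | false = refl
    ... | true | false = ⊥-elim (f-bridge (reverseʷ (toU d sd) ++ʷ cons e (s , e≢f) (Joins-sym j) (toW c sc)))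
    ... | false | true = ⊥-elim (f-bridge (reverseʷ (toU c sc) ++ʷ cons e (s , e≢f) j (toW d sd)))

    walk-same-side : ∀ {c d} → Walk (G ends) (Tree-minus f) c d → side c ≡ side d
    walk-same-side nil = refl
    walk-same-side (cons e (s , e≢f) j p) = trans (same-side s e≢f j) (walk-same-side p)

    crossing-tree-edge : ∀ {e c d} → Tr e ≡ true → Joins (G ends) e c d → side c ≢ side d → e ≡ f
    crossing-tree-edge {e} s j sc≢sd with e ≟ᶠ f
    ... | yes e≡f = e≡f
    ... | no e≢f = ⊥-elim (sc≢sd (same-side s e≢f j))

    w-side⇒≢u : ∀ {c} → side c ≡ true → c ≢ u
    w-side⇒≢u sc refl = false≢true (trans (sym side-u) sc)

    avoidingU⇒avoidingF : ∀ {c d} (p : Walk (G ends) Tree c d) → All (u ≢_) (walkVerts (G ends) p) →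
                          Walk (G ends) (Tree-minus f) c d
    avoidingU⇒avoidingF nil _ = nil
    avoidingU⇒avoidingF (cons e s j p) (u≢c ∷ rest) = cons e (s , e≢f) j (avoidingU⇒avoidingF p rest)
      where
      e≢f : e ≢ f
      e≢f refl with Joins-unique j f-uw
      ... | inj₁ (c≡u , _) = u≢c (sym c≡u)
      ... | inj₂ (_ , next≡u) = All-head p rest (sym next≡u)

    w-side-avoids-u : ∀ {c d} (p : Walk (G ends) (Tree-minus f) c d) → side c ≡ true →
                      Walk (G ends) (MinusV (G ends) Tree u) c d
    w-side-avoids-u nil _ = nil
    w-side-avoids-u (cons e (s , e≢f) j p) sc =
      let sc' = trans (sym (same-side s e≢f j)) sc in
      cons e (s , Joins⇒¬Incident j (w-side⇒≢u sc) (w-side⇒≢u sc')) j (w-side-avoids-u p sc')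

    -- The cut on V': the subdivision vertex v_f joins w's side, every other
    -- subdivision vertex lies on the side of its tree edge.
    side' : Vertex' → Bool
    side' (inj₁ v) = side v
    side' (inj₂ (t , _)) = does (t ≟ᶠ f) ∨ side (src t)

    side'-v_f : ∀ s → side' (inj₂ (f , s)) ≡ true
    side'-v_f s with f ≟ᶠ f
    ... | yes _ = refl
    ... | no f≢f = ⊥-elim (f≢f refl)

    side'-subdivision : ∀ {e a c} (s : Tr e ≡ true) → e ≢ f → Joins (G ends) e a c →
                        side' (inj₂ (e , s)) ≡ side a
    side'-subdivision {e} s e≢f j with e ≟ᶠ f | src-end j
    ... | yes e≡f | _ = ⊥-elim (e≢f e≡f)
    ... | no _ | inj₁ src≡a = cong side src≡a
    ... | no _ | inj₂ src≡c = trans (cong side src≡c) (sym (same-side s e≢f j))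

    orientation : Joins (G ends) f u w → Bool
    orientation (inj₁ _) = true
    orientation (inj₂ _) = false

    half : TreeEdge × Bool
    half = (f , f∈T) , orientation f-uw

    Separates : Vertex' → Vertex' → Set
    Separates x y = side' x ≢ side' y

    only-half-separated-ends : ∀ (t : TreeEdge) b →
      Separates (proj₁ (ends' ends Tr r lend (inj₁ (t , b)))) (proj₂ (ends' ends Tr r lend (inj₁ (t , b)))) →
      (t , b) ≡ half
    only-half-separated-ends (e , s) b sep with e ≟ᶠ f
    only-half-separated-ends (e , s) true sep | no e≢f = ⊥-elim (sep (sym (side'-subdivision s e≢f (inj₁ refl))))
    only-half-separated-ends (e , s) false sep | no e≢f = ⊥-elim (sep (side'-subdivision s e≢f (inj₂ refl)))
    only-half-separated-ends (e , s) b sep | yes refl = helper f-uw b sep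
      where
      helper : (j : Joins (G ends) f u w) (b : Bool) →
        Separates (proj₁ (ends' ends Tr r lend (inj₁ ((f , s) , b)))) (proj₂ (ends' ends Tr r lend (inj₁ ((f , s) , b)))) →
        ((f , s) , b) ≡ ((f , f∈T) , orientation j)
      helper (inj₁ _) true _ = cong (λ z → (f , z) , true) (≡true-irrelevant s f∈T)
      helper (inj₂ p) true sep = ⊥-elim (sep (trans (cong side (cong proj₁ p)) (trans side-w (sym (side'-v_f s)))))
      helper (inj₁ p) false sep = ⊥-elim (sep (trans (side'-v_f s) (sym (trans (cong side (cong proj₂ p)) side-w))))
      helper (inj₂ _) false _ = cong (λ z → (f , z) , false) (≡true-irrelevant s f∈T)

    only-half-separated : ∀ {t b c d} → Joins Subdivided (inj₁ (t , b)) c d → Separates c d → (t , b) ≡ half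
    only-half-separated {t} {b} (inj₁ p) sep =
      only-half-separated-ends t b (λ eq → sep (trans (cong side' (sym (cong proj₁ p))) (trans eq (cong side' (cong proj₂ p)))))
    only-half-separated {t} {b} (inj₂ p) sep =
      only-half-separated-ends t b (λ eq → sep (trans (cong side' (sym (cong proj₂ p))) (trans (sym eq) (cong side' (cong proj₁ p)))))

    -- An end a of a link ℓ is represented in ℓ' by a vertex on
    -- the side of a, provided a ≠ u or u is the root or a leaf; if u is
    -- internal, the end u is represented on the side of the other end of ℓ.
    Avoids-u : Fin n → Set
    Avoids-u a = a ≢ u ⊎ RL u

    avoids⇒≢u : ∀ {a} → Avoids-u a → ¬ RL a → a ≢ u
    avoids⇒≢u (inj₁ a≢u) _ = a≢u
    avoids⇒≢u (inj₂ rlu) ¬rl a≡u = ¬rl (subst RL (sym a≡u) rlu)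

    link-end-side : ∀ {a b x} → Avoids-u a → EndSpec ends Tr r a b x → side' x ≡ side a
    link-end-side {a} avoids (atRL , atInternal) with rootOrLeaf? a
    ... | yes rl rewrite atRL rl = refl
    ... | no ¬rl with atInternal ¬rl
    ...   | _ , refl , (nil , _) , ()
    ...   | (e , s) , refl , (cons e s' j _ , _) , refl with toSum (e ≟ᶠ f)
    ...     | inj₂ e≢f = side'-subdivision s e≢f j
    ...     | inj₁ refl with Joins-unique j f-uw
    ...       | inj₁ (a≡u , _) = ⊥-elim (avoids⇒≢u avoids ¬rl a≡u)
    ...       | inj₂ (a≡w , _) = trans (side'-v_f s) (sym (trans (cong side a≡w) side-w))

    link-end-at-u : ∀ {b x} → ¬ RL u → EndSpec ends Tr r u b x → side' x ≡ side b
    link-end-at-u ¬rl (_ , atInternal) with atInternal ¬rl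
    ... | _ , refl , (nil , _) , ()
    ... | (e , s) , refl , (cons {w = c} e s' j rest , (u∉rest ∷ _)) , refl =
      trans first-edge (walk-same-side (avoidingU⇒avoidingF rest u∉rest))
      where
      first-edge : side' (inj₂ (e , s)) ≡ side c
      first-edge with toSum (e ≟ᶠ f)
      ... | inj₂ e≢f = side'-subdivision s e≢f (Joins-sym j)
      ... | inj₁ refl with Joins-unique j f-uw
      ...   | inj₁ (_ , c≡w) = trans (side'-v_f s) (sym (trans (cong side c≡w) side-w))
      ...   | inj₂ (u≡w , _) = ⊥-elim (Joins-distinct f-uw u≡w)

    Separated : Link → Set
    Separated ℓ = Separates (proj₁ (lend ℓ)) (proj₂ (lend ℓ))

    link-separated : ∀ {ℓ c d} → Joins Subdivided (inj₂ ℓ) c d → Separates c d → Separated ℓ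
    link-separated (inj₁ p) sep eq = sep (trans (cong side' (sym (cong proj₁ p))) (trans eq (cong side' (cong proj₂ p))))
    link-separated (inj₂ p) sep eq = sep (trans (cong side' (sym (cong proj₂ p))) (trans (sym eq) (cong side' (cong proj₁ p))))

    spec₁ : ∀ {e} (te : Tr e ≡ false) → EndSpec ends Tr r (src e) (tgt e) (proj₁ (lend (e , te)))
    spec₁ te = proj₁ (linkSpec (_ , te))

    spec₂ : ∀ {e} (te : Tr e ≡ false) → EndSpec ends Tr r (tgt e) (src e) (proj₂ (lend (e , te)))
    spec₂ te = proj₂ (linkSpec (_ , te))

    separated⇐ : ∀ {e} (te : Tr e ≡ false) → Avoids-u (src e) → Avoids-u (tgt e) →
                 side (src e) ≢ side (tgt e) → Separated (e , te)
    separated⇐ te avoids₁ avoids₂ sides≢ eq =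
      sides≢ (trans (sym (link-end-side avoids₁ (spec₁ te))) (trans eq (link-end-side avoids₂ (spec₂ te))))

    unseparated-at-u : ∀ {b x₁ x₂} → ¬ RL u → b ≢ u →
                       EndSpec ends Tr r u b x₁ → EndSpec ends Tr r b u x₂ → side' x₁ ≡ side' x₂
    unseparated-at-u ¬rl b≢u end₁ end₂ = trans (link-end-at-u ¬rl end₁) (sym (link-end-side (inj₁ b≢u) end₂))

    separated⇒ : ∀ {e} (te : Tr e ≡ false) → ¬ RL u → Separated (e , te) →
                 (src e ≢ u) × (tgt e ≢ u) × (side (src e) ≢ side (tgt e))
    separated⇒ {e} te ¬rl sep with src e ≟ᶠ u | tgt e ≟ᶠ u
    ... | yes src≡u | _ =
          ⊥-elim (sep (unseparated-at-u ¬rl (λ tgt≡u → Joins-distinct {e} (inj₁ refl) (trans src≡u (sym tgt≡u)))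
                        (subst (λ z → EndSpec ends Tr r z (tgt e) _) src≡u (spec₁ te))
                        (subst (λ z → EndSpec ends Tr r (tgt e) z _) src≡u (spec₂ te))))
    ... | no src≢u | yes tgt≡u =
          ⊥-elim (sep (sym (unseparated-at-u ¬rl src≢u
                             (subst (λ z → EndSpec ends Tr r z (src e) _) tgt≡u (spec₂ te))
                             (subst (λ z → EndSpec ends Tr r (src e) z _) tgt≡u (spec₁ te)))))
    ... | no src≢u | no tgt≢u =
          src≢u , tgt≢u , λ eq → sep (trans (link-end-side (inj₁ src≢u) (spec₁ te))
                                      (trans eq (sym (link-end-side (inj₁ tgt≢u) (spec₂ te)))))

    f-leaves-u's-side : ∀ {c d} → Joins (G ends) f c d → side d ≡ false → d ≢ u → ⊥
    f-leaves-u's-side j sd d≢u with Joins-unique j f-uw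
    ... | inj₁ (_ , d≡w) = false≢true (trans (sym sd) (trans (cong side d≡w) side-w))
    ... | inj₂ (_ , d≡u) = d≢u d≡u

    separated⇒covers-half : ∀ ℓ → Separated ℓ → TreePathContains ends Tr r lend ℓ half
    separated⇒covers-half ℓ sep with shortcut' (T'-walk (proj₁ (lend ℓ)) (proj₂ (lend ℓ)))
    ... | P , uniq with SubWalks.separatingEdge side' P sep
    ...   | inj₂ _ , _ , _ , () , _
    ...   | inj₁ h , _ , _ , _ , j , cd-separated , h∈P =
            (P , uniq) , subst (λ z → inj₁ z ∈ walkEdges Subdivided P) (only-half-separated j cd-separated) h∈P

    separatedᵇ : ∀ e b → Tr e ≡ b → Bool
    separatedᵇ e true _ = false
    separatedᵇ e false te = side' (proj₁ (lend (e , te))) xor side' (proj₂ (lend (e , te)))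

    separatedLinks : List (Fin m)
    separatedLinks = select (λ e → separatedᵇ e (Tr e) refl) (allFin m)

    ∈separatedLinks⁻ : ∀ {e} → e ∈ separatedLinks → Σ[ te ∈ Tr e ≡ false ] Separated (e , te)
    ∈separatedLinks⁻ {e} e∈ = from (Tr e) refl (∈-select⁻ _ (allFin m) e∈)
      where
      from : ∀ b (q : Tr e ≡ b) → separatedᵇ e b q ≡ true → Σ[ te ∈ Tr e ≡ false ] Separated (e , te)
      from false q sep = q , xor⇒≢ sep

    ∈separatedLinks⁺ : ∀ {e} (te : Tr e ≡ false) → Separated (e , te) → e ∈ separatedLinks
    ∈separatedLinks⁺ {e} te sep = ∈-select⁺ _ (∈-allFin e) (to (Tr e) refl)
      where
      to : ∀ b (q : Tr e ≡ b) → separatedᵇ e b q ≡ true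
      to true q = ⊥-elim (false≢true (trans (sym te) q))
      to false q = subst (λ p → separatedᵇ e false p ≡ true) (≡false-irrelevant te q) (≢⇒xor sep)

    crossing-link∈ : ∀ {e c d} → Tr e ≡ false → Joins (G ends) e c d → Avoids-u c → Avoids-u d →
                     side c ≢ side d → e ∈ separatedLinks
    crossing-link∈ te j avoids-c avoids-d sides≢ =
      let avoids₁ , avoids₂ , sides≢' = via-ends Crosses Crosses-sym j (avoids-c , avoids-d , sides≢)
      in ∈separatedLinks⁺ te (separated⇐ te avoids₁ avoids₂ sides≢')
      where
      Crosses : Fin n → Fin n → Set
      Crosses a b = Avoids-u a × Avoids-u b × side a ≢ side b
      Crosses-sym : ∀ {a b} → Crosses a b → Crosses b a
      Crosses-sym (α , β , ne) = β , α , λ eq → ne (sym eq)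

    -- If u is the root or a leaf, deleting f and the separated links would
    -- disconnect u from w; so there are at least two separated links.
    few-separated-rootOrLeaf : RL u → length separatedLinks ≤ 1 → ⊥
    few-separated-rootOrLeaf rl few
      with crossingEdge side (walk-avoiding (f ∷ []) separatedLinks (s≤s (s≤s (ℕ.≤-trans few (s≤s z≤n)))) u w)
                        side-u side-w
    ... | e , c , d , (_ , e∉D) , j , sc , sd , _ with Tr e in te
    ...   | true = e∉D (here (crossing-tree-edge te j (≡false∧≡true⇒≢ sc sd)))
    ...   | false = e∉D (there (crossing-link∈ te j (inj₂ rl) (inj₂ rl) (≡false∧≡true⇒≢ sc sd)))

    sides-∨ : ∀ {e c d} → Joins (G ends) e c d → side (src e) ∨ side (tgt e) ≡ side c ∨ side d
    sides-∨ (inj₁ p) = cong (λ z → side (proj₁ z) ∨ side (proj₂ z)) p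
    sides-∨ {c = c} {d} (inj₂ p) = trans (cong (λ z → side (proj₁ z) ∨ side (proj₂ z)) p) (∨-comm (side d) (side c))

    -- For internal u the four edges at u are split into those reaching w's
    -- side (f, and links with an end there) and the others.
    reachesW : Fin m → Bool
    reachesW e = does (e ≟ᶠ f) ∨ (not (Tr e) ∧ (side (src e) ∨ side (tgt e)))

    towardW awayW : List (Fin m)
    towardW = select (λ e → incb ends e u ∧ reachesW e) (allFin m)
    awayW = select (λ e → incb ends e u ∧ not (reachesW e)) (allFin m)

    edges-at-u : length towardW + length awayW ≡ 4
    edges-at-u = trans (count-split (λ e → incb ends e u) reachesW (allFin m)) (regular u)

    f∈towardW : f ∈ towardW
    f∈towardW = ∈-select⁺ _ (∈-allFin f) (cong₂ _∧_ (Joins⇒incb f-uw) reaches)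
      where
      reaches : reachesW f ≡ true
      reaches with f ≟ᶠ f
      ... | yes _ = refl
      ... | no f≢f = ⊥-elim (f≢f refl)

    link∈towardW : ∀ {e d} → Tr e ≡ false → Joins (G ends) e u d → side d ≡ true → e ∈ towardW
    link∈towardW {e} te j sd = ∈-select⁺ _ (∈-allFin e) (cong₂ _∧_ (Joins⇒incb j) reaches)
      where
      some-end-on-w's-side : side (src e) ∨ side (tgt e) ≡ true
      some-end-on-w's-side = trans (sides-∨ j) (trans (cong (side u ∨_) sd) (∨-zeroʳ (side u)))
      reaches : reachesW e ≡ true
      reaches rewrite te | some-end-on-w's-side = ∨-zeroʳ (does (e ≟ᶠ f))

    ∈awayW : ∀ {e d} → Joins (G ends) e u d → e ≢ f →
             (Tr e ≡ true) ⊎ (side (src e) ∨ side (tgt e) ≡ false) → e ∈ awayW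
    ∈awayW {e} j e≢f tree-or-u's-side = ∈-select⁺ _ (∈-allFin e) (cong₂ _∧_ (Joins⇒incb j) (away tree-or-u's-side))
      where
      away : (Tr e ≡ true) ⊎ (side (src e) ∨ side (tgt e) ≡ false) → not (reachesW e) ≡ true
      away h with e ≟ᶠ f
      ... | yes e≡f = ⊥-elim (e≢f e≡f)
      away (inj₁ te) | no _ rewrite te = refl
      away (inj₂ sides) | no _ rewrite sides | ∧-zeroʳ (not (Tr e)) = refl

    -- deleting the separated links and towardW leaves no edge from u's side to w's side
    few-separated-towardW : length separatedLinks + length towardW < 4 → ⊥
    few-separated-towardW small
      with crossingEdge side (walk-avoiding separatedLinks towardW small u w) side-u side-w
    ... | e , c , d , (_ , e∉D) , j , sc , sd , _ with Tr e in te | c ≟ᶠ u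
    ...   | true | _ =
            e∉D (∈-++⁺ʳ separatedLinks (subst (_∈ towardW) (sym (crossing-tree-edge te j (≡false∧≡true⇒≢ sc sd))) f∈towardW))
    ...   | false | yes refl = e∉D (∈-++⁺ʳ separatedLinks (link∈towardW te j sd))
    ...   | false | no c≢u =
            e∉D (∈-++⁺ˡ (crossing-link∈ te j (inj₁ c≢u) (inj₁ (w-side⇒≢u sd)) (≡false∧≡true⇒≢ sc sd)))

    another-tree-edge : ¬ RL u → Σ[ g ∈ Fin m ] Σ[ z ∈ Fin n ] (Tr g ≡ true × g ≢ f × Joins (G ends) g u z)
    another-tree-edge ¬rl with another-element (treeEdgesAt u) (treeEdgesAt-unique u) (∈treeEdgesAt⁺ f∈T f-uw)
                                                (λ deg≡1 → ¬rl (inj₂ deg≡1))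
    ... | g , g∈ , g≢f with ∈treeEdgesAt⁻ g∈
    ...   | z , g∈T , g-uz = g , z , g∈T , g≢f , g-uz

    beyondU : Fin n → Bool
    beyondU v = not (does (v ≟ᶠ u) ∨ side v)

    beyondU-u : beyondU u ≡ false
    beyondU-u with u ≟ᶠ u
    ... | yes _ = refl
    ... | no u≢u = ⊥-elim (u≢u refl)

    beyondU⁺ : ∀ {v} → side v ≡ false → v ≢ u → beyondU v ≡ true
    beyondU⁺ {v} sv v≢u with v ≟ᶠ u
    ... | yes v≡u = ⊥-elim (v≢u v≡u)
    ... | no _ rewrite sv = refl

    beyondU-true⁻ : ∀ {v} → beyondU v ≡ true → side v ≡ false × v ≢ u
    beyondU-true⁻ {v} bv with v ≟ᶠ u | side v in sv
    beyondU-true⁻ () | yes _ | _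
    beyondU-true⁻ () | no _ | true
    ... | no v≢u | false = refl , v≢u

    beyondU-false⁻ : ∀ {v} → beyondU v ≡ false → (v ≡ u) ⊎ (side v ≡ true)
    beyondU-false⁻ {v} bv with v ≟ᶠ u | side v in sv
    ... | yes v≡u | _ = inj₁ v≡u
    ... | no _ | true = inj₂ refl
    beyondU-false⁻ () | no _ | false

    beyondU-boundary : ∀ {e c d} → Joins (G ends) e c d → beyondU c ≡ false → beyondU d ≡ true →
                       e ∈ separatedLinks ++ awayW
    beyondU-boundary {e} j bc bd with beyondU-true⁻ bd | beyondU-false⁻ bc | Tr e in te
    ... | sd , d≢u | inj₁ refl | true =
          ∈-++⁺ʳ separatedLinks (∈awayW j (λ { refl → f-leaves-u's-side j sd d≢u }) (inj₁ te))
    ... | sd , d≢u | inj₁ refl | false =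
          ∈-++⁺ʳ separatedLinks (∈awayW j (λ { refl → false≢true (trans (sym te) f∈T) })
            (inj₂ (trans (sides-∨ j) (cong₂ _∨_ side-u sd))))
    ... | sd , d≢u | inj₂ sc | true with crossing-tree-edge te j (λ eq → false≢true (trans (sym sd) (trans (sym eq) sc)))
    ...   | refl = ⊥-elim (f-leaves-u's-side j sd d≢u)
    beyondU-boundary {e} j bc bd | sd , d≢u | inj₂ sc | false =
          ∈-++⁺ˡ (crossing-link∈ te j (inj₁ (w-side⇒≢u sc)) (inj₁ d≢u) (λ eq → false≢true (trans (sym sd) (trans (sym eq) sc))))

    -- deleting the separated links and awayW separates u from the far end z of g
    few-separated-awayW : ¬ RL u → length separatedLinks + length awayW < 4 → ⊥
    few-separated-awayW ¬rl small with another-tree-edge ¬rl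
    ... | g , z , g∈T , g≢f , g-uz
      with crossingEdge beyondU (walk-avoiding separatedLinks awayW small u z) beyondU-u
             (beyondU⁺ (trans (sym (same-side g∈T g≢f g-uz)) side-u) (λ z≡u → Joins-distinct g-uz (sym z≡u)))
    ...   | e , c , d , (_ , e∉D) , j , bc , bd , _ = e∉D (beyondU-boundary j bc bd)

    two-separated-links : ¬ (length separatedLinks ≤ 1)
    two-separated-links few with rootOrLeaf? u
    ... | yes rl = few-separated-rootOrLeaf rl few
    ... | no ¬rl with small-plus-one-part _ _ _ few edges-at-u
    ...   | inj₁ small = few-separated-towardW small
    ...   | inj₂ small = few-separated-awayW ¬rl small

    two-covering-links : Σ[ ℓ₁ ∈ Link ] Σ[ ℓ₂ ∈ Link ]
      (ℓ₁ ≢ ℓ₂ × TreePathContains ends Tr r lend ℓ₁ half × TreePathContains ends Tr r lend ℓ₂ half)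
    two-covering-links = firstTwo separatedLinks (select-unique _ (Unique.allFin⁺ m)) ∈separatedLinks⁻ two-separated-links
      where
      firstTwo : (es : List (Fin m)) → Unique es → (∀ {e} → e ∈ es → Σ[ te ∈ Tr e ≡ false ] Separated (e , te)) →
                 ¬ (length es ≤ 1) → Σ[ ℓ₁ ∈ Link ] Σ[ ℓ₂ ∈ Link ]
                   (ℓ₁ ≢ ℓ₂ × TreePathContains ends Tr r lend ℓ₁ half × TreePathContains ends Tr r lend ℓ₂ half)
      firstTwo [] _ _ long = ⊥-elim (long z≤n)
      firstTwo (_ ∷ []) _ _ long = ⊥-elim (long (s≤s z≤n))
      firstTwo (e₁ ∷ e₂ ∷ _) ((e₁≢e₂ ∷ _) ∷ _) separated _ with separated (here refl) | separated (there (here refl))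
      ... | t₁ , sep₁ | t₂ , sep₂ =
            (e₁ , t₁) , (e₂ , t₂) , (λ eq → e₁≢e₂ (cong proj₁ eq)) ,
            separated⇒covers-half (e₁ , t₁) sep₁ , separated⇒covers-half (e₂ , t₂) sep₂

  covered-twice : (e' : TreeEdge × Bool) → Σ[ ℓ₁ ∈ Link ] Σ[ ℓ₂ ∈ Link ]
    (ℓ₁ ≢ ℓ₂ × TreePathContains ends Tr r lend ℓ₁ e' × TreePathContains ends Tr r lend ℓ₂ e')
  covered-twice ((f , f∈T) , true) = FundamentalCut.two-covering-links f f∈T (src f) (tgt f) (inj₁ refl)
  covered-twice ((f , f∈T) , false) = FundamentalCut.two-covering-links f f∈T (tgt f) (src f) (inj₂ refl)

  -- Part (1): 2-vertex-connectivity of T + F.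

  -- the root of T and two of its neighbours in G are three distinct vertices
  three-vertices : Σ[ a ∈ Fin n ] Σ[ b ∈ Fin n ] Σ[ c ∈ Fin n ] (a ≢ b × a ≢ c × b ≢ c)
  three-vertices
    with two-elements (select (λ e → incb ends e r) (allFin m)) (select-unique _ (Unique.allFin⁺ m))
                      (subst (2 ≤_) (sym (regular r)) (s≤s (s≤s z≤n)))
  ... | e₁ , e₂ , e₁∈ , e₂∈ , e₁≢e₂
    with incb⇒Joins (∈-select⁻ _ (allFin m) e₁∈) | incb⇒Joins (∈-select⁻ _ (allFin m) e₂∈)
  ...   | y₁ , j₁ | y₂ , j₂ =
          r , y₁ , y₂ , Joins-distinct j₁ , Joins-distinct j₂ , λ { refl → e₁≢e₂ (no-parallel j₁ j₂) }

  -- x has at most three tree edges (it has at most four edges, and not four tree edges)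
  tree-deg≤3 : ∀ x → deg ends Tr x ≤ 3
  tree-deg≤3 x = ℕ.≤-pred (ℕ.≤∧≢⇒< deg≤4 (noTreeDeg4 x))
    where
    deg≤4 : deg ends Tr x ≤ 4
    deg≤4 = subst (deg ends Tr x ≤_) (regular x)
      (unique-⊆-length (treeEdgesAt x) (select (λ e → incb ends e x) (allFin m)) (treeEdgesAt-unique x)
        λ {g} g∈ → ∈-select⁺ _ (∈-allFin g) (proj₂ (∧≡true⁻ (∈-select⁻ _ (allFin m) g∈))))

  four-tree-edges : ∀ {x} (gs : List (Fin m)) → length gs ≡ 4 → Unique gs → All (_∈ treeEdgesAt x) gs → ⊥
  four-tree-edges {x} gs len uniq at = ¬4≤3 (ℕ.≤-trans (subst (_≤ deg ends Tr x) len four≤deg) (tree-deg≤3 x))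
    where
    four≤deg : length gs ≤ deg ends Tr x
    four≤deg = unique-⊆-length gs (treeEdgesAt x) uniq (All.lookup at)
    ¬4≤3 : ¬ (4 ≤ 3)
    ¬4≤3 (s≤s (s≤s (s≤s ())))

  two-tree-edges⇒internal : ∀ {x g₁ g₂ y₁ y₂} → Tr g₁ ≡ true → Joins (G ends) g₁ x y₁ →
    Tr g₂ ≡ true → Joins (G ends) g₂ x y₂ → g₁ ≢ g₂ → ¬ RL x
  two-tree-edges⇒internal {x} {g₁} {g₂} t₁ j₁ t₂ j₂ g₁≢g₂ rl = ¬2≤1 (subst (2 ≤_) (deg≡1 rl) two≤deg)
    where
    two≤deg : 2 ≤ deg ends Tr x
    two≤deg = unique-⊆-length (g₁ ∷ g₂ ∷ []) (treeEdgesAt x) ((g₁≢g₂ ∷ []) ∷ [] ∷ [])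
                λ { (here refl) → ∈treeEdgesAt⁺ t₁ j₁ ; (there (here refl)) → ∈treeEdgesAt⁺ t₂ j₂ }
    deg≡1 : RL x → deg ends Tr x ≡ 1
    deg≡1 (inj₁ refl) = rootIsLeaf
    deg≡1 (inj₂ deg≡1) = deg≡1
    ¬2≤1 : ¬ (2 ≤ 1)
    ¬2≤1 (s≤s ())

  module Part1 (F' : Link → Bool) (ec2 : EdgeConnected Subdivided 2 (T'+ ends Tr r lend F')) where

    Without : Fin n → Fin m → Set
    Without x = MinusV (G ends) (T+ ends Tr r lend F') x

    tree⇒Without : ∀ {x a b} → Walk (G ends) (MinusV (G ends) Tree x) a b → Walk (G ends) (Without x) a b
    tree⇒Without = mapʷ λ (s , e∌x) → inj₁ s , e∌x

    -- A link ab of F jumping over x, from the branch of T at x containing the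
    -- tree edge f = xy to the branch of another tree edge g = xz.
    record Jump (x : Fin n) (f : Fin m) (y : Fin n) : Set where
      field
        link     : Link
        link∈F   : F' link ≡ true
        a b      : Fin n
        link-ab  : Joins (G ends) (proj₁ link) a b
        a≢x      : a ≢ x
        b≢x      : b ≢ x
        a→y      : Walk (G ends) (MinusV (G ends) Tree x) a y
        g        : Fin m
        z        : Fin n
        g∈T      : Tr g ≡ true
        g≢f      : g ≢ f
        g-xz     : Joins (G ends) g x z
        b→z      : Walk (G ends) (MinusV (G ends) Tree x) b z

    jump-walk : ∀ {x f y} (J : Jump x f y) → Walk (G ends) (Without x) y (Jump.z J)
    jump-walk J = reverseʷ (tree⇒Without a→y) ++ʷ
                  cons (proj₁ link) (inj₂ (proj₂ link , link∈F) , Joins⇒¬Incident link-ab a≢x b≢x) link-ab nil ++ʷ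
                  tree⇒Without b→z
      where open Jump J

    -- Every tree edge f = xy at an internal vertex x admits a jump: a path
    -- of T' + F' from x to v_f avoiding the half-edge x v_f crosses the cut
    -- of f along a separated link of F.
    module Jumping (f : Fin m) (f∈T : Tr f ≡ true) (x y : Fin n) (f-xy : Joins (G ends) f x y) (¬rl : ¬ RL x) where
      open FundamentalCut f f∈T x y f-xy

      jump-from : ∀ ℓ → F' ℓ ≡ true → ∀ {a b} → Joins (G ends) (proj₁ ℓ) a b → a ≢ x → b ≢ x →
                  side a ≡ true → side b ≡ false → Jump x f y
      jump-from ℓ ℓ∈F {a} {b} link-ab a≢x b≢x sa sb with enteringEdge (tree-walk b x) b≢x
      ... | g , z , g∈T , g-xz , b→z = record
        { link = ℓ ; link∈F = ℓ∈F ; a = a ; b = b ; link-ab = link-ab ; a≢x = a≢x ; b≢x = b≢x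
        ; a→y = w-side-avoids-u (toW a sa) sa
        ; g = g ; z = z ; g∈T = g∈T ; g≢f = g≢f ; g-xz = g-xz ; b→z = b→z }
        where
        -- b→z stays on x's side, while f leads to y on the other side
        g≢f : g ≢ f
        g≢f refl = false≢true (trans (sym sb) (trans (walk-same-side (avoidingVertex⇒avoidingEdge (Joins⇒Incident f-xy) b→z))
                                                  (trans (cong side (Joins-other g-xz f-xy)) side-w)))

      jump-along : ∀ {e} (te : Tr e ≡ false) → F' (e , te) ≡ true → Separated (e , te) → Jump x f y
      jump-along {e} te e∈F sep with separated⇒ te ¬rl sep
      ... | src≢x , tgt≢x , sides≢ with side (src e) in s₁ | side (tgt e) in s₂
      ...   | true | true = ⊥-elim (sides≢ refl)
      ...   | false | false = ⊥-elim (sides≢ refl)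
      ...   | true | false = jump-from (e , te) e∈F (inj₁ refl) src≢x tgt≢x s₁ s₂
      ...   | false | true = jump-from (e , te) e∈F (inj₂ refl) tgt≢x src≢x s₂ s₁

      jump : Jump x f y
      jump with SubWalks.crossingEdge side' (ec2 (inj₁ half ∷ []) (s≤s (s≤s z≤n)) (inj₁ x) (inj₂ (f , f∈T))) side-u (side'-v_f f∈T)
      ... | inj₁ h , _ , _ , (_ , ∉half) , j , sc , sd , _ =
            ⊥-elim (∉half (here (cong inj₁ (only-half-separated j (≡false∧≡true⇒≢ sc sd)))))
      ... | inj₂ (e , te) , _ , _ , (e∈F , _) , j , sc , sd , _ =
            jump-along te e∈F (link-separated j (≡false∧≡true⇒≢ sc sd))

    -- Two jumps at x connect the branches of f₁ and f₂, because x has at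
    -- most three tree edges: two of f₁, f₂ and the target edges of the jumps coincide.
    via-jumps : ∀ {x f₁ y₁ f₂ y₂} → Joins (G ends) f₁ x y₁ → Joins (G ends) f₂ x y₂ → f₁ ≢ f₂ →
                Tr f₁ ≡ true → Tr f₂ ≡ true → Jump x f₁ y₁ → Jump x f₂ y₂ → Walk (G ends) (Without x) y₁ y₂
    via-jumps {f₁ = f₁} {f₂ = f₂} j₁ j₂ f₁≢f₂ t₁ t₂ J₁ J₂ with Jump.g J₁ ≟ᶠ f₂ | Jump.g J₂ ≟ᶠ f₁ | Jump.g J₁ ≟ᶠ Jump.g J₂
    ... | yes g₁≡f₂ | _ | _ = jump-walk J₁ ++ʷ walk-to-equal (Joins-other-≡ g₁≡f₂ (Jump.g-xz J₁) j₂)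
    ... | no _ | yes g₂≡f₁ | _ = reverseʷ (jump-walk J₂ ++ʷ walk-to-equal (Joins-other-≡ g₂≡f₁ (Jump.g-xz J₂) j₁))
    ... | no _ | no _ | yes g₁≡g₂ =
          jump-walk J₁ ++ʷ walk-to-equal (Joins-other-≡ g₁≡g₂ (Jump.g-xz J₁) (Jump.g-xz J₂)) ++ʷ reverseʷ (jump-walk J₂)
    ... | no g₁≢f₂ | no g₂≢f₁ | no g₁≢g₂ =
          ⊥-elim (four-tree-edges (f₁ ∷ f₂ ∷ Jump.g J₁ ∷ Jump.g J₂ ∷ []) refl
            ((f₁≢f₂ ∷ ≢-sym (Jump.g≢f J₁) ∷ ≢-sym g₂≢f₁ ∷ []) ∷ (≢-sym g₁≢f₂ ∷ ≢-sym (Jump.g≢f J₂) ∷ []) ∷ (g₁≢g₂ ∷ []) ∷ [] ∷ [])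
            (∈treeEdgesAt⁺ t₁ j₁ ∷ ∈treeEdgesAt⁺ t₂ j₂ ∷ ∈treeEdgesAt⁺ (Jump.g∈T J₁) (Jump.g-xz J₁) ∷
             ∈treeEdgesAt⁺ (Jump.g∈T J₂) (Jump.g-xz J₂) ∷ []))

    neighbours-linked : ∀ {x f₁ y₁ f₂ y₂} → Tr f₁ ≡ true → Joins (G ends) f₁ x y₁ →
                        Tr f₂ ≡ true → Joins (G ends) f₂ x y₂ → Walk (G ends) (Without x) y₁ y₂
    neighbours-linked {x} {f₁} {_} {f₂} t₁ j₁ t₂ j₂ with f₁ ≟ᶠ f₂
    ... | yes refl = walk-to-equal (Joins-other j₁ j₂)
    ... | no f₁≢f₂ =
          via-jumps j₁ j₂ f₁≢f₂ t₁ t₂ (Jumping.jump f₁ t₁ _ _ j₁ internal) (Jumping.jump f₂ t₂ _ _ j₂ internal)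
      where
      internal : ¬ RL x
      internal = two-tree-edges⇒internal t₁ j₁ t₂ j₂ f₁≢f₂

    -- Deleting x: the tree walks from a and b to x enter x from neighbours of
    -- x, which are linked in (T + F) − x.
    connected-without : ∀ x a b → a ≢ x → b ≢ x → Walk (G ends) (Without x) a b
    connected-without x a b a≢x b≢x with enteringEdge (tree-walk a x) a≢x | enteringEdge (tree-walk b x) b≢x
    ... | _ , _ , t₁ , j₁ , a→y₁ | _ , _ , t₂ , j₂ , b→y₂ =
          tree⇒Without a→y₁ ++ʷ neighbours-linked t₁ j₁ t₂ j₂ ++ʷ reverseʷ (tree⇒Without b→y₂)

    two-vertex-connected : TwoVertexConnected (G ends) (T+ ends Tr r lend F')
    two-vertex-connected = three-vertices , connected-without

lemma15 : (n m : ℕ) (ends : Fin m → Fin n × Fin n) →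
    Simple ends → Regular ends 4 → EdgeConnected (G ends) 4 (λ _ → ⊤) →
    (Tr : Fin m → Bool) → SpanningTree (G ends) (In ends Tr) →
    (∀ v → deg ends Tr v ≢ 4) →
    (r : Fin n) → deg ends Tr r ≡ 1 →
    (lend : LE ends Tr r → V' ends Tr r × V' ends Tr r) → LinkSpec ends Tr r lend →
    ((F' : LE ends Tr r → Bool) →
      EdgeConnected (G' ends Tr r lend) 2 (T'+ ends Tr r lend F') →
      TwoVertexConnected (G ends) (T+ ends Tr r lend F')) ×
    ((e' : TE ends Tr r × Bool) →
      Σ[ ℓ₁ ∈ LE ends Tr r ] Σ[ ℓ₂ ∈ LE ends Tr r ]
        (ℓ₁ ≢ ℓ₂ × TreePathContains ends Tr r lend ℓ₁ e' × TreePathContains ends Tr r lend ℓ₂ e'))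
lemma15 n m ends simple regular edgeConn Tr spanning noTreeDeg4 r rootIsLeaf lend linkSpec =
  Part1.two-vertex-connected , covered-twice
  where
  open Lemma15 ends simple regular edgeConn Tr spanning noTreeDeg4 r rootIsLeaf lend linkSpec
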